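{- Let $T=(\mathbf{P},A,\to)$ be an LTS with signature $\{A^r,A^l,A^{bi}\}$. Then for any two states $p,q\in\mathbf{P}$: $p\lesssim_{cc}q$ in $\mathcal{T}(T)$ if and only if $p\lesssim_{cc}q$ in $\mathcal{T}_0(T)$, where $\mathcal{T}(T)$ and $\mathcal{T}_0(T)$ are the transformed LTSs defined in the context.
   Context: A signature $\{A^r,A^l,A^{bi}\}$ is a partition of the action set $A$ into covariant ($A^r$), contravariant ($A^l$) and bivariant ($A^{bi}$) actions. For an LTS with such a signature, a covariant-contravariant simulation is a relation $R$ on states such that whenever $p\,R\,q$: for all $a\in A^r\cup A^{bi}$ and all $p\xrightarrow{a}p'$ there is $q\xrightarrow{a}q'$ with $p'\,R\,q'$; and for all $a\in A^l\cup A^{bi}$ and all $q\xrightarrow{a}q'$ there is $p\xrightarrow{a}p'$ with $p'\,R\,q'$; $p\lesssim_{cc}q$ iff some such $R$ contains $(p,q)$. The LTS $\mathcal{T}(T)$ has signature $\{\bar A^r,\bar A^l,\emptyset\}$ with $\bar A^r=A^r\cup\{c^r\mid c\in A^{bi}\}$ and $\bar A^l=A^l\cup\{c^l\mid c\in A^{bi}\}$ (fresh actions $c^r,c^l$); its states are those of $T$; it contains all transitions of $T$ labelled in $A^r\cup A^l$, and for each transition $p\xrightarrow{c}p'$ of $T$ with $c\in A^{bi}$ it contains $p\xrightarrow{c^r}p'$ and $p\xrightarrow{c^l}p'$ (and nothing else). The LTS $\mathcal{T}_0(T)$ has signature $\{\hat A^r,\hat A^l,\emptyset\}$ with $\hat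 A^r=\{d^r\mid d\in A^r\cup A^{bi}\}$ and $\hat A^l=\{d^l\mid d\in A^r\cup A^l\cup A^{bi}\}$ (fresh actions); its states are those of $T$ plus a new state $u$; for each transition $p\xrightarrow{d}p'$ of $T$ it has $p\xrightarrow{d^l}p'$; for each transition $p\xrightarrow{d}p'$ of $T$ with $d\in A^r\cup A^{bi}$ it has $p\xrightarrow{d^r}p'$; for each $a\in A^r$ and each state $p$ (including $u$) it has $p\xrightarrow{a^l}u$; and it has $u\xrightarrow{d^l}u$ for every $d\in A$ (and nothing else). -}

module Defs where

open import Data.Product using (Σ; ∃; _×_; _,_)
open import Data.Sum using (_⊎_)
open import Relation.Binary.PropositionalEquality using (_≡_)

-- Kinds of actions: a signature {A^r, A^l, A^bi} is a function assigning
-- each action its (unique) kind, i.e. a partition of the action set.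
data Kind : Set where
  cov contra bi : Kind

record LTS : Set₁ where
  field
    State  : Set
    Action : Set
    kind   : Action → Kind
    _⟶[_]_ : State → Action → State → Set

module _ (T : LTS) where
  open LTS T

  CovLike : Action → Set
  CovLike a = kind a ≡ cov ⊎ kind a ≡ bi

  ContraLike : Action → Set
  ContraLike a = kind a ≡ contra ⊎ kind a ≡ bi

  IsCCSim : (State → State → Set) → Set
  IsCCSim R = ∀ p q → R p q →
      (∀ a → CovLike a → ∀ p' → p ⟶[ a ] p' →
         ∃ λ q' → (q ⟶[ a ] q') × R p' q')
    × (∀ a → ContraLike a → ∀ q' → q ⟶[ a ] q' →
         ∃ λ p' → (p ⟶[ a ] p') × R p' q')

  _≲cc_ : State → State → Set₁
  p ≲cc q = Σ (State → State → Set) λ R → IsCCSim R × R p q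

module _ (T : LTS) where
  open LTS T

  data TAct : Set where
    orig-r : (a : Action) → kind a ≡ cov    → TAct
    orig-l : (a : Action) → kind a ≡ contra → TAct
    c-r    : (c : Action) → kind c ≡ bi     → TAct
    c-l    : (c : Action) → kind c ≡ bi     → TAct

  TKind : TAct → Kind
  TKind (orig-r _ _) = cov
  TKind (orig-l _ _) = contra
  TKind (c-r _ _)    = cov
  TKind (c-l _ _)    = contra

  TStep : State → TAct → State → Set
  TStep p (orig-r a _) p' = p ⟶[ a ] p'
  TStep p (orig-l a _) p' = p ⟶[ a ] p'
  TStep p (c-r c _)    p' = p ⟶[ c ] p'
  TStep p (c-l c _)    p' = p ⟶[ c ] p'

  𝒯 : LTS
  𝒯 = record { State = State ; Action = TAct ; kind = TKind ; _⟶[_]_ = TStep }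

module _ (T : LTS) where
  open LTS T

  data T0State : Set where
    st : State → T0State
    u  : T0State

  data T0Act : Set where
    d-r : (d : Action) → kind d ≡ cov ⊎ kind d ≡ bi → T0Act
    d-l : (d : Action) → T0Act

  T0Kind : T0Act → Kind
  T0Kind (d-r _ _) = cov
  T0Kind (d-l _)   = contra

  data T0Step : T0State → T0Act → T0State → Set where
    step-l : ∀ {p d p'} → p ⟶[ d ] p' → T0Step (st p) (d-l d) (st p')
    step-r : ∀ {p d p'} (k : kind d ≡ cov ⊎ kind d ≡ bi) →
             p ⟶[ d ] p' → T0Step (st p) (d-r d k) (st p')
    to-u   : ∀ {s a} → kind a ≡ cov → T0Step s (d-l a) u
    u-loop : ∀ {d} → T0Step u (d-l d) u

  𝒯₀ : LTS
  𝒯₀ = record { State = T0State ; Action = T0Act ; kind = T0Kind ; _⟶[_]_ = T0Step }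

module Submission where

-- Both sides of the corollary are compared with the cc-simulation preorder of
-- T itself.
--
-- * 𝒯(T) has exactly the same cc-simulations as T: a bivariant action c of T
--   is split into a covariant copy c^r, carrying the forward obligation, and a
--   contravariant copy c^l, carrying the backward one (sim⇒𝒯-sim, 𝒯-sim⇒sim).
-- * For 𝒯₀(T), a simulation R of T is lifted by relating the new state u to
--   every state (u only has contravariant moves, all answered by its own loops)
--   and never relating an original state to u.  The backward obligations d^l
--   with d ∈ A^r, which T does not have, are answered by the jump to u
--   (lift-sim).  Conversely a simulation of 𝒯₀(T) restricted to the original
--   states is one of T: for a contravariant-like action the answer cannot be
--   the jump to u, which exists only for covariant actions (restrict-sim).

open import Defs
open import Function.Bundles using (_⇔_; mk⇔)
open import Function.Properties.Equivalence using () renaming (trans to ⇔-trans)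
open import Data.Product using (∃; _×_; _,_; proj₁; proj₂)
open import Data.Sum using (_⊎_; inj₁; inj₂)
open import Data.Unit using (⊤; tt)
open import Data.Empty using (⊥; ⊥-elim)
open import Relation.Nullary using (¬_)
open import Relation.Binary.PropositionalEquality using (_≡_; refl; sym; trans)

module _ (T : LTS) where
  open LTS T

  Forth Back : (State → State → Set) → State → State → Set
  Forth R p q = ∀ a → CovLike T a → ∀ p' → p ⟶[ a ] p' →
                  ∃ λ q' → (q ⟶[ a ] q') × R p' q'
  Back  R p q = ∀ a → ContraLike T a → ∀ q' → q ⟶[ a ] q' →
                  ∃ λ p' → (p ⟶[ a ] p') × R p' q'

  contra-¬CovLike : ∀ a → kind a ≡ contra → ¬ CovLike T a
  contra-¬CovLike _ k (inj₁ k') with trans (sym k) k'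
  ... | ()
  contra-¬CovLike _ k (inj₂ k') with trans (sym k) k'
  ... | ()

  cov-¬ContraLike : ∀ a → kind a ≡ cov → ¬ ContraLike T a
  cov-¬ContraLike _ k (inj₁ k') with trans (sym k) k'
  ... | ()
  cov-¬ContraLike _ k (inj₂ k') with trans (sym k) k'
  ... | ()

  cov-or-ContraLike : ∀ a → kind a ≡ cov ⊎ ContraLike T a
  cov-or-ContraLike a with kind a
  ... | cov    = inj₁ refl
  ... | contra = inj₂ (inj₁ refl)
  ... | bi     = inj₂ (inj₂ refl)

module _ {T : LTS} where
  open LTS T

  sim⇒𝒯-sim : ∀ {R} → IsCCSim T R → IsCCSim (𝒯 T) R
  sim⇒𝒯-sim {R} sim p q r = forth , back
    where
    forth : Forth (𝒯 T) R p q
    forth (orig-r a k) _  = proj₁ (sim p q r) a (inj₁ k)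
    forth (c-r c k)    _  = proj₁ (sim p q r) c (inj₂ k)
    forth a@(orig-l _ _) cl = ⊥-elim (contra-¬CovLike (𝒯 T) a refl cl)
    forth a@(c-l _ _)    cl = ⊥-elim (contra-¬CovLike (𝒯 T) a refl cl)
    back : Back (𝒯 T) R p q
    back (orig-l a k) _  = proj₂ (sim p q r) a (inj₁ k)
    back (c-l c k)    _  = proj₂ (sim p q r) c (inj₂ k)
    back a@(orig-r _ _) cl = ⊥-elim (cov-¬ContraLike (𝒯 T) a refl cl)
    back a@(c-r _ _)    cl = ⊥-elim (cov-¬ContraLike (𝒯 T) a refl cl)

  𝒯-sim⇒sim : ∀ {R} → IsCCSim (𝒯 T) R → IsCCSim T R
  𝒯-sim⇒sim {R} sim p q r = forth , back
    where
    forth : Forth T R p q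
    forth a (inj₁ k) = proj₁ (sim p q r) (orig-r a k) (inj₁ refl)
    forth a (inj₂ k) = proj₁ (sim p q r) (c-r a k)    (inj₁ refl)
    back : Back T R p q
    back a (inj₁ k) = proj₂ (sim p q r) (orig-l a k) (inj₁ refl)
    back a (inj₂ k) = proj₂ (sim p q r) (c-l a k)    (inj₁ refl)

  ≲cc-𝒯 : ∀ {p q} → _≲cc_ (𝒯 T) p q ⇔ _≲cc_ T p q
  ≲cc-𝒯 = mk⇔ (λ (R , sim , r) → R , 𝒯-sim⇒sim sim , r)
              (λ (R , sim , r) → R , sim⇒𝒯-sim sim , r)

  lift : (State → State → Set) → T0State T → T0State T → Set
  lift R (st p) (st q) = R p q
  lift R (st p) u      = ⊥
  lift R u      _      = ⊤

  restrict : (T0State T → T0State T → Set) → State → State → Set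
  restrict R₀ p q = R₀ (st p) (st q)

  lift-sim : ∀ {R} → IsCCSim T R → IsCCSim (𝒯₀ T) (lift R)
  lift-sim {R} sim (st p) (st q) r = forth , back
    where
    forth : Forth (𝒯₀ T) (lift R) (st p) (st q)
    forth (d-r d k) _ (st p') (step-r _ t) with proj₁ (sim p q r) d k p' t
    ... | q' , t' , r' = st q' , step-r k t' , r'
    forth a@(d-l _) cl = ⊥-elim (contra-¬CovLike (𝒯₀ T) a refl cl)
    back : Back (𝒯₀ T) (lift R) (st p) (st q)
    back a@(d-r _ _) cl = ⊥-elim (cov-¬ContraLike (𝒯₀ T) a refl cl)
    back (d-l _) _ u (to-u k) = u , to-u k , tt
    back (d-l d) _ (st q') (step-l t) with cov-or-ContraLike T d
    ... | inj₁ k  = u , to-u k , tt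
    ... | inj₂ cl with proj₂ (sim p q r) d cl q' t
    ...   | p' , t' , r' = st p' , step-l t' , r'
  lift-sim _ (st _) u ()
  lift-sim {R} _ u s _ = forth , back
    where
    forth : Forth (𝒯₀ T) (lift R) u s
    forth (d-r _ _) _ _ ()
    forth a@(d-l _) cl = ⊥-elim (contra-¬CovLike (𝒯₀ T) a refl cl)
    back : Back (𝒯₀ T) (lift R) u s
    back a@(d-r _ _) cl = ⊥-elim (cov-¬ContraLike (𝒯₀ T) a refl cl)
    back (d-l _) _ _ _ = u , u-loop , tt

  restrict-sim : ∀ {R₀} → IsCCSim (𝒯₀ T) R₀ → IsCCSim T (restrict R₀)
  restrict-sim {R₀} sim p q r = forth , back
    where
    forth : Forth T (restrict R₀) p q
    forth a k p' t
      with proj₁ (sim (st p) (st q) r) (d-r a k) (inj₁ refl) (st p') (step-r k t)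
    ... | st q' , step-r _ t' , r' = q' , t' , r'
    -- the answer to an a^l-move cannot be the jump to u, as a is not covariant
    back : Back T (restrict R₀) p q
    back a cl q' t
      with proj₂ (sim (st p) (st q) r) (d-l a) (inj₁ refl) (st q') (step-l t)
    ... | st p' , step-l t' , r' = p' , t' , r'
    ... | u , to-u k , _ = ⊥-elim (cov-¬ContraLike T a k cl)

  ≲cc-𝒯₀ : ∀ {p q} → _≲cc_ T p q ⇔ _≲cc_ (𝒯₀ T) (st p) (st q)
  ≲cc-𝒯₀ = mk⇔ (λ (R , sim , r) → lift R , lift-sim sim , r)
               (λ (R₀ , sim , r) → restrict R₀ , restrict-sim sim , r)

corollary22 : (T : LTS) (p q : LTS.State T) →
    (_≲cc_ (𝒯 T) p q) ⇔ (_≲cc_ (𝒯₀ T) (st p) (st q))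
corollary22 T p q = ⇔-trans ≲cc-𝒯 ≲cc-𝒯₀
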